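{- Let $\Sigma$ be a finite set of propositional variables. For every SeCe formula $D$ over $\Sigma$ of size $n$ one can effectively construct a deterministic finite automaton over the alphabet $2^{\Sigma}$ with $O(2^{2^{2^{n}}})$ states that accepts exactly the language $\{\sigma\mid\sigma\models D\}$.
   Context: Words: a word over $\Sigma$ is a finite sequence $\sigma=P_0\cdots P_n$ with $P_i\subseteq\Sigma$; $\mathrm{dom}(\sigma)=\{0,\dots,n\}$, $\sigma(i)=P_i$. Propositional formulas over $\Sigma$: $\varphi ::= 0\mid 1\mid p\in\Sigma\mid \varphi\wedge\varphi\mid\varphi\vee\varphi\mid\neg\varphi$, with $\sigma,i\models\varphi$ defined as usual. An interval of $\sigma$ is $[b,e]$ with $b\le e$ in $\mathrm{dom}(\sigma)$. QDDC formulas: $D::=\langle\varphi\rangle\mid[\varphi]\mid[[\varphi]]\mid\{\{\varphi\}\}\mid D\,\hat{}\,D\mid\neg D\mid D\vee D\mid D\wedge D\mid D^*\mid \exists p.D\mid\forall p.D\mid \mathit{slen}\bowtie c\mid \mathit{scount}\,\varphi\bowtie c\mid \mathit{sdur}\,\varphi\bowtie c$, where $c\in\mathbb N$ and $\bowtie\in\{<,\le,=,\ge,>\}$. Semantics on an interval $[b,e]$ of $\sigma$: $\langle\varphi\rangle$ iff $\sigma,b\models\varphi$; $[\varphi]$ iff $\sigma,i\models\varphi$ for all $b\le i<e$; $[[\varphi]]$ iff $\sigma,i\models\varphi$ for all $b\le i\le e$; $\{\{\varphi\}\}$ iff $e=b+1$ and $\sigma,b\models\varphi$; boolean connectives as usual;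 $D_1\hat{}D_2$ iff there is $b\le i\le e$ with $\sigma,[b,i]\models D_1$ and $\sigma,[i,e]\models D_2$; $D^*$ iff there are $b=i_0\le\dots\le i_k=e$ ($k\ge0$) with $\sigma,[i_j,i_{j+1}]\models D$ for all $j<k$; $\exists p.D$ iff $D$ holds on $[b,e]$ in some word differing from $\sigma$ only in the value of $p$; $\forall p.D$ iff $\neg\exists p.\neg D$; $\mathit{slen}=e-b$, $\mathit{scount}\,\varphi$ counts $i\in[b,e]$ with $\sigma,i\models\varphi$, $\mathit{sdur}\,\varphi$ counts $i\in[b,e-1]$ with $\sigma,i\models\varphi$. For $\sigma=P_0\cdots P_n$, $\sigma\models D$ iff $\sigma,[0,n]\models D$. A SeCe (semi-extended chop expression) formula is a QDDC formula using none of $\exists p$, $\forall p$ and negation $\neg D$ (conjunction is allowed). The size of a formula is its length, with numeric constants written in binary. -}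

module Defs where

open import Data.Nat using (ℕ; zero; suc; _+_; _*_; _∸_; _≤_; _<_; _≥_; _>_)
open import Data.Nat.Logarithm using (⌊log₂_⌋)
open import Data.Bool using (Bool; true; false; _∧_; _∨_; not)
open import Data.Fin using (Fin)
open import Data.Fin.Subset using (Subset; ⊥)
open import Data.Vec using (lookup)
open import Data.List using (List; []; _∷_; foldl)
open import Data.List.NonEmpty using (List⁺; _∷_; toList) renaming (length to length⁺)
open import Data.Product using (Σ; _×_; _,_)
open import Data.Sum using (_⊎_)
open import Relation.Nullary using (¬_)
open import Relation.Binary.PropositionalEquality using (_≡_; _≢_)

-- The finite set Σ of propositional variables is Fin k.
-- A letter is a subset of Σ (a bit vector of length k).
Letter : ℕ → Set
Letter k = Subset k

Word : ℕ → Set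
Word k = List⁺ (Letter k)

-- last index n of a word (dom σ = {0,…,n})
lastIdx : ∀ {k} → Word k → ℕ
lastIdx (_ ∷ xs) = Data.List.length xs

-- letter at position i (positions outside dom σ yield the empty set; never
-- used inside dom σ)
atL : ∀ {k} → List (Letter k) → ℕ → Letter k
atL []       _       = ⊥
atL (x ∷ xs) zero    = x
atL (x ∷ xs) (suc i) = atL xs i

at : ∀ {k} → Word k → ℕ → Letter k
at w i = atL (toList w) i

data Prop (k : ℕ) : Set where
  pfalse ptrue : Prop k
  pvar  : Fin k → Prop k
  _p∧_ _p∨_ : Prop k → Prop k → Prop k
  p¬    : Prop k → Prop k

evalP : ∀ {k} → Letter k → Prop k → Bool
evalP P pfalse    = false
evalP P ptrue     = true
evalP P (pvar p)  = lookup P p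
evalP P (φ p∧ ψ)  = evalP P φ ∧ evalP P ψ
evalP P (φ p∨ ψ)  = evalP P φ ∨ evalP P ψ
evalP P (p¬ φ)    = not (evalP P φ)

_,_⊨ₚ_ : ∀ {k} → Word k → ℕ → Prop k → Set
σ , i ⊨ₚ φ = evalP (at σ i) φ ≡ true

data Cmp : Set where
  `< `≤ `= `≥ `> : Cmp

cmpSem : Cmp → ℕ → ℕ → Set
cmpSem `< a c = a < c
cmpSem `≤ a c = a ≤ c
cmpSem `= a c = a ≡ c
cmpSem `≥ a c = a ≥ c
cmpSem `> a c = a > c

data QDDC (k : ℕ) : Set where
  ⟨_⟩ [_] [[_]] ⦃⦃_⦄⦄ : Prop k → QDDC k
  _⁀_ : QDDC k → QDDC k → QDDC k
  ¬ᴰ_ : QDDC k → QDDC k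
  _∨ᴰ_ _∧ᴰ_ : QDDC k → QDDC k → QDDC k
  _⋆ : QDDC k → QDDC k
  ∃ᴰ ∀ᴰ : Fin k → QDDC k → QDDC k
  slen : Cmp → ℕ → QDDC k
  scount sdur : Prop k → Cmp → ℕ → QDDC k

-- SeCe formulas: no ∃p, ∀p, and no negation ¬D
data IsSeCe {k : ℕ} : QDDC k → Set where
  s⟨⟩    : ∀ φ → IsSeCe ⟨ φ ⟩
  s[]    : ∀ φ → IsSeCe [ φ ]
  s[[]]  : ∀ φ → IsSeCe [[ φ ]]
  s⦃⦃⦄⦄  : ∀ φ → IsSeCe ⦃⦃ φ ⦄⦄
  s⁀     : ∀ {D₁ D₂} → IsSeCe D₁ → IsSeCe D₂ → IsSeCe (D₁ ⁀ D₂)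
  s∨     : ∀ {D₁ D₂} → IsSeCe D₁ → IsSeCe D₂ → IsSeCe (D₁ ∨ᴰ D₂)
  s∧     : ∀ {D₁ D₂} → IsSeCe D₁ → IsSeCe D₂ → IsSeCe (D₁ ∧ᴰ D₂)
  s⋆     : ∀ {D} → IsSeCe D → IsSeCe (D ⋆)
  sslen  : ∀ r c → IsSeCe (slen r c)
  sscount : ∀ φ r c → IsSeCe (scount φ r c)
  ssdur  : ∀ φ r c → IsSeCe (sdur φ r c)

-- Size (length) of formulas; numeric constants written in binary.
binLen : ℕ → ℕ
binLen c = suc ⌊log₂ c ⌋

sizeP : ∀ {k} → Prop k → ℕ
sizeP pfalse   = 1
sizeP ptrue    = 1
sizeP (pvar _) = 1
sizeP (φ p∧ ψ) = sizeP φ + 1 + sizeP ψ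
sizeP (φ p∨ ψ) = sizeP φ + 1 + sizeP ψ
sizeP (p¬ φ)   = 1 + sizeP φ

size : ∀ {k} → QDDC k → ℕ
size ⟨ φ ⟩         = 2 + sizeP φ
size [ φ ]         = 2 + sizeP φ
size [[ φ ]]       = 4 + sizeP φ
size ⦃⦃ φ ⦄⦄       = 4 + sizeP φ
size (D₁ ⁀ D₂)     = size D₁ + 1 + size D₂
size (¬ᴰ D)        = 1 + size D
size (D₁ ∨ᴰ D₂)    = size D₁ + 1 + size D₂
size (D₁ ∧ᴰ D₂)    = size D₁ + 1 + size D₂
size (D ⋆)         = size D + 1
size (∃ᴰ p D)      = 2 + size D
size (∀ᴰ p D)      = 2 + size D
size (slen r c)    = 2 + binLen c
size (scount φ r c) = 2 + sizeP φ + binLen c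
size (sdur φ r c)  = 2 + sizeP φ + binLen c

countP : ∀ {k} → Word k → Prop k → ℕ → ℕ → ℕ
countP σ φ b zero      = 0
countP σ φ b (suc len) with evalP (at σ b) φ
... | true  = suc (countP σ φ (suc b) len)
... | false = countP σ φ (suc b) len

data Chain (R : ℕ → ℕ → Set) : ℕ → ℕ → Set where
  done : ∀ {b} → Chain R b b
  step : ∀ {b i e} → b ≤ i → R b i → Chain R i e → Chain R b e

Variant : ∀ {k} → Fin k → Word k → Word k → Set
Variant p σ σ' =
  (length⁺ σ' ≡ length⁺ σ) × (∀ i q → q ≢ p → lookup (at σ' i) q ≡ lookup (at σ i) q)

-- σ, [b, e] ⊨ D   (only used for intervals b ≤ e ≤ lastIdx σ)
Sat : ∀ {k} → QDDC k → Word k → ℕ → ℕ → Set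
Sat ⟨ φ ⟩ σ b e = σ , b ⊨ₚ φ
Sat [ φ ] σ b e = ∀ i → b ≤ i → i < e → σ , i ⊨ₚ φ
Sat [[ φ ]] σ b e = ∀ i → b ≤ i → i ≤ e → σ , i ⊨ₚ φ
Sat ⦃⦃ φ ⦄⦄ σ b e = (e ≡ suc b) × (σ , b ⊨ₚ φ)
Sat (D₁ ⁀ D₂) σ b e = Σ ℕ λ i → (b ≤ i) × (i ≤ e) × Sat D₁ σ b i × Sat D₂ σ i e
Sat (¬ᴰ D) σ b e = ¬ Sat D σ b e
Sat (D₁ ∨ᴰ D₂) σ b e = Sat D₁ σ b e ⊎ Sat D₂ σ b e
Sat (D₁ ∧ᴰ D₂) σ b e = Sat D₁ σ b e × Sat D₂ σ b e
Sat (D ⋆) σ b e = Chain (Sat D σ) b e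
Sat (∃ᴰ p D) σ b e = Σ (Word _) λ σ' → Variant p σ σ' × Sat D σ' b e
Sat (∀ᴰ p D) σ b e = ¬ (Σ (Word _) λ σ' → Variant p σ σ' × ¬ Sat D σ' b e)
Sat (slen r c) σ b e = cmpSem r (e ∸ b) c
Sat (scount φ r c) σ b e = cmpSem r (countP σ φ b (suc (e ∸ b))) c
Sat (sdur φ r c) σ b e = cmpSem r (countP σ φ b (e ∸ b)) c

_⊨_ : ∀ {k} → Word k → QDDC k → Set
σ ⊨ D = Sat D σ 0 (lastIdx σ)

record DFA (k : ℕ) : Set where
  field
    states : ℕ
    start  : Fin states
    δ      : Fin states → Letter k → Fin states
    final  : Fin states → Bool

accepts : ∀ {k} → DFA k → List (Letter k) → Bool
accepts A w = DFA.final A (foldl (DFA.δ A) (DFA.start A) w)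

module Submission where

-- A SeCe formula D is compiled, by structural recursion, into a
-- nondeterministic automaton that reads the letters σ(b) ⋯ σ(e) of an
-- interval and accepts exactly when σ, [b, e] ⊨ D.  Atomic formulas are
-- recognised by a "window" automaton remembering the first letter, a
-- counter capped just above the relevant constant, and the current letter;
-- ∨, ∧, ⁀ and * are handled by union, product, chop and star constructions.
-- Each construction at most squares the number of states while the formula
-- grows by one, so D needs at most 2^2^(size D) states.  The subset
-- construction, plus one state for the empty prefix, then gives a DFA with
-- at most 2 · 2^2^2^(size D) states.

open import Defs
open import Data.Nat
  using (ℕ; zero; suc; _+_; _*_; _∸_; _^_; _≤_; _<_; z≤n; s≤s; z<s; _⊓_; _≟_; _≤?_; _<?_)
open import Data.Nat.Properties
open import Data.Nat.Logarithm using (⌊log₂_⌋; ⌊log₂⌋-mono-≤; ⌊log₂[2^n]⌋≡n)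
open import Data.Bool using (Bool; true; false; not)
open import Data.Bool.Properties using (not-injective) renaming (_≟_ to _≟ᵇ_)
open import Data.Fin using (Fin; zero; suc; toℕ; fromℕ<)
open import Data.Fin.Properties
  using (any?; +↔⊎; *↔×; 1↔⊤; 2↔Bool; toℕ-fromℕ<; fromℕ<-cong) renaming (_≟_ to _≟ᶠ_)
open import Data.Vec using (Vec; []; _∷_; lookup; tabulate)
open import Data.Vec.Properties using (lookup∘tabulate)
open import Data.List using (List; []; _∷_; drop; length; foldl)
open import Data.List.NonEmpty using (_∷_; toList)
open import Data.Unit using (⊤; tt)
open import Data.Empty using (⊥; ⊥-elim)
open import Data.Product using (Σ; ∃; _×_; _,_; proj₁; proj₂; uncurry)
open import Data.Product.Properties using (≡-dec)
open import Data.Product.Function.NonDependent.Propositional using (_×-↔_; _×-⇔_)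
open import Data.Sum using (_⊎_; inj₁; inj₂)
open import Data.Sum.Function.Propositional using (_⊎-↔_; _⊎-⇔_)
open import Function using (_∘_; id)
open import Function.Bundles using (_⇔_; mk⇔; Equivalence; _↔_; Inverse; mk↔ₛ′)
open import Function.Properties.Equivalence using () renaming (trans to ⇔-trans; sym to ⇔-sym)
open import Function.Properties.Inverse using (↔-trans; ↔-refl)
open import Relation.Nullary using (Dec; yes; no; does; contradiction)
open import Relation.Nullary.Decidable using (map′; _×-dec_; _⊎-dec_)
open import Relation.Binary.PropositionalEquality

open Equivalence using (to; from)

≡⇒⇔ : ∀ {A : Set} (P : A → Set) {x y : A} → x ≡ y → P x ⇔ P y
≡⇒⇔ P x≡y = mk⇔ (subst P x≡y) (subst P (sym x≡y))

does-true : ∀ {P : Set} (P? : Dec P) → does P? ≡ true ⇔ P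
does-true (yes p) = mk⇔ (λ _ → p) (λ _ → refl)
does-true (no ¬p) = mk⇔ (λ ()) (λ p → ⊥-elim (¬p p))

∃-dec : ∀ {m} {S : Set} {P : S → Set} → Fin m ↔ S → (∀ s → Dec (P s)) → Dec (∃ P)
∃-dec {P = P} enum P? =
  map′ (λ (i , p) → to′ i , p)
       (λ (s , p) → from′ s , subst P (sym (strictlyInverseˡ s)) p)
       (any? (P? ∘ to′))
  where open Inverse enum renaming (to to to′; from to from′)

bitVectors : ∀ m → Fin (2 ^ m) ↔ Vec Bool m
bitVectors zero = mk↔ₛ′ (λ _ → []) (λ _ → zero) (λ { [] → refl }) (λ { zero → refl })
bitVectors (suc m) = ↔-trans *↔× (↔-trans (2↔Bool ×-↔ bitVectors m) cons↔)
  where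
  cons↔ : (Bool × Vec Bool m) ↔ Vec Bool (suc m)
  cons↔ = mk↔ₛ′ (uncurry _∷_) (λ { (x ∷ xs) → x , xs }) (λ { (x ∷ xs) → refl }) (λ _ → refl)

-- A run
-- starts in a state allowed by the first letter, so that the one-letter
-- interval [b, b] is read as well; states are enumerated and all
-- relations are decidable.
record NFA (k : ℕ) : Set₁ where
  field
    State    : Set
    card     : ℕ
    enum     : Fin card ↔ State
    Initial  : Letter k → State → Set
    Step     : State → Letter k → State → Set
    Final    : State → Set
    initial? : ∀ a q → Dec (Initial a q)
    step?    : ∀ p a q → Dec (Step p a q)
    final?   : ∀ q → Dec (Final q)

module _ {k} (A : NFA k) (σ : Word k) where
  open NFA A

  data Run (b : ℕ) : ℕ → State → Set where
    start  : ∀ {q} → Initial (at σ b) q → Run b b q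
    extend : ∀ {j p q} → Run b j p → Step p (at σ (suc j)) q → Run b (suc j) q

  Accepts : ℕ → ℕ → Set
  Accepts b e = ∃ λ q → Run b e q × Final q

module _ {k} {A : NFA k} {σ : Word k} where

  run-≤ : ∀ {b e q} → Run A σ b e q → b ≤ e
  run-≤ (start _)    = ≤-refl
  run-≤ (extend r _) = m≤n⇒m≤1+n (run-≤ r)

  accepts-≤ : ∀ {b e} → Accepts A σ b e → b ≤ e
  accepts-≤ (_ , r , _) = run-≤ r

Recognises : ∀ {k} → NFA k → QDDC k → Set
Recognises A D = ∀ σ b e → b ≤ e → Accepts A σ b e ⇔ Sat D σ b e

module Union {k} (A₁ A₂ : NFA k) where
  private
    module A₁ = NFA A₁
    module A₂ = NFA A₂

  State : Set
  State = A₁.State ⊎ A₂.State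

  Initial : Letter k → State → Set
  Initial a (inj₁ q) = A₁.Initial a q
  Initial a (inj₂ q) = A₂.Initial a q

  Step : State → Letter k → State → Set
  Step (inj₁ p) a (inj₁ q) = A₁.Step p a q
  Step (inj₂ p) a (inj₂ q) = A₂.Step p a q
  Step _        _ _        = ⊥

  Final : State → Set
  Final (inj₁ q) = A₁.Final q
  Final (inj₂ q) = A₂.Final q

  union : NFA k
  union = record
    { State    = State
    ; card     = A₁.card + A₂.card
    ; enum     = ↔-trans +↔⊎ (A₁.enum ⊎-↔ A₂.enum)
    ; Initial  = Initial
    ; Step     = Step
    ; Final    = Final
    ; initial? = λ { a (inj₁ q) → A₁.initial? a q ; a (inj₂ q) → A₂.initial? a q }
    ; step?    = λ { (inj₁ p) a (inj₁ q) → A₁.step? p a q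
                   ; (inj₂ p) a (inj₂ q) → A₂.step? p a q
                   ; (inj₁ p) a (inj₂ q) → no λ ()
                   ; (inj₂ p) a (inj₁ q) → no λ () }
    ; final?   = λ { (inj₁ q) → A₁.final? q ; (inj₂ q) → A₂.final? q }
    }

  module _ (σ : Word k) where

    run-inj₁⁻¹ : ∀ {b e q} → Run union σ b e (inj₁ q) → Run A₁ σ b e q
    run-inj₁⁻¹ (start h)                   = start h
    run-inj₁⁻¹ (extend {p = inj₁ _} r s)   = extend (run-inj₁⁻¹ r) s
    run-inj₁⁻¹ (extend {p = inj₂ _} _ ())

    run-inj₂⁻¹ : ∀ {b e q} → Run union σ b e (inj₂ q) → Run A₂ σ b e q
    run-inj₂⁻¹ (start h)                   = start h
    run-inj₂⁻¹ (extend {p = inj₂ _} r s)   = extend (run-inj₂⁻¹ r) s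
    run-inj₂⁻¹ (extend {p = inj₁ _} _ ())

    run-inj₁ : ∀ {b e q} → Run A₁ σ b e q → Run union σ b e (inj₁ q)
    run-inj₁ (start h)    = start h
    run-inj₁ (extend r s) = extend (run-inj₁ r) s

    run-inj₂ : ∀ {b e q} → Run A₂ σ b e q → Run union σ b e (inj₂ q)
    run-inj₂ (start h)    = start h
    run-inj₂ (extend r s) = extend (run-inj₂ r) s

    accepts-union : ∀ b e → Accepts union σ b e ⇔ (Accepts A₁ σ b e ⊎ Accepts A₂ σ b e)
    accepts-union b e = mk⇔ split merge
      where
      split : Accepts union σ b e → Accepts A₁ σ b e ⊎ Accepts A₂ σ b e
      split (inj₁ q , r , f) = inj₁ (q , run-inj₁⁻¹ r , f)
      split (inj₂ q , r , f) = inj₂ (q , run-inj₂⁻¹ r , f)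
      merge : Accepts A₁ σ b e ⊎ Accepts A₂ σ b e → Accepts union σ b e
      merge (inj₁ (q , r , f)) = inj₁ q , run-inj₁ r , f
      merge (inj₂ (q , r , f)) = inj₂ q , run-inj₂ r , f

module Product {k} (A₁ A₂ : NFA k) where
  private
    module A₁ = NFA A₁
    module A₂ = NFA A₂

  product : NFA k
  product = record
    { State    = A₁.State × A₂.State
    ; card     = A₁.card * A₂.card
    ; enum     = ↔-trans *↔× (A₁.enum ×-↔ A₂.enum)
    ; Initial  = λ a (q₁ , q₂) → A₁.Initial a q₁ × A₂.Initial a q₂
    ; Step     = λ (p₁ , p₂) a (q₁ , q₂) → A₁.Step p₁ a q₁ × A₂.Step p₂ a q₂
    ; Final    = λ (q₁ , q₂) → A₁.Final q₁ × A₂.Final q₂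
    ; initial? = λ a (q₁ , q₂) → A₁.initial? a q₁ ×-dec A₂.initial? a q₂
    ; step?    = λ (p₁ , p₂) a (q₁ , q₂) → A₁.step? p₁ a q₁ ×-dec A₂.step? p₂ a q₂
    ; final?   = λ (q₁ , q₂) → A₁.final? q₁ ×-dec A₂.final? q₂
    }

  module _ (σ : Word k) where

    run-unzip : ∀ {b e q₁ q₂} → Run product σ b e (q₁ , q₂) → Run A₁ σ b e q₁ × Run A₂ σ b e q₂
    run-unzip (start (h₁ , h₂))    = start h₁ , start h₂
    run-unzip (extend r (s₁ , s₂)) = let (r₁ , r₂) = run-unzip r in extend r₁ s₁ , extend r₂ s₂

    -- Two runs on the same interval have the same length, so they zip.
    run-zip : ∀ {b e q₁ q₂} → Run A₁ σ b e q₁ → Run A₂ σ b e q₂ → Run product σ b e (q₁ , q₂)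
    run-zip (start h₁)     (start h₂)     = start (h₁ , h₂)
    run-zip (extend r₁ s₁) (extend r₂ s₂) = extend (run-zip r₁ r₂) (s₁ , s₂)
    run-zip (start _)      (extend r₂ _)  = ⊥-elim (1+n≰n (run-≤ r₂))
    run-zip (extend r₁ _)  (start _)      = ⊥-elim (1+n≰n (run-≤ r₁))

    accepts-product : ∀ b e → Accepts product σ b e ⇔ (Accepts A₁ σ b e × Accepts A₂ σ b e)
    accepts-product b e = mk⇔
      (λ ((q₁ , q₂) , r , (f₁ , f₂)) →
         let (r₁ , r₂) = run-unzip r in (q₁ , r₁ , f₁) , (q₂ , r₂ , f₂))
      (λ ((q₁ , r₁ , f₁) , (q₂ , r₂ , f₂)) → (q₁ , q₂) , run-zip r₁ r₂ , (f₁ , f₂))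

-- Chop: run A₁ and, on the letter where A₁ accepts, switch to A₂, which
-- starts reading that same letter (the two intervals share their
-- common endpoint).
module Chop {k} (A₁ A₂ : NFA k) where
  private
    module A₁ = NFA A₁
    module A₂ = NFA A₂

  State : Set
  State = A₁.State ⊎ A₂.State

  EndsFirstAfterInit : Letter k → Set
  EndsFirstAfterInit a = ∃ λ q₁ → A₁.Initial a q₁ × A₁.Final q₁

  EndsFirstAfterStep : A₁.State → Letter k → Set
  EndsFirstAfterStep p a = ∃ λ q₁ → A₁.Step p a q₁ × A₁.Final q₁

  Initial : Letter k → State → Set
  Initial a (inj₁ q) = A₁.Initial a q
  Initial a (inj₂ q) = A₂.Initial a q × EndsFirstAfterInit a

  Step : State → Letter k → State → Set
  Step (inj₁ p) a (inj₁ q) = A₁.Step p a q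
  Step (inj₁ p) a (inj₂ q) = A₂.Initial a q × EndsFirstAfterStep p a
  Step (inj₂ p) a (inj₂ q) = A₂.Step p a q
  Step (inj₂ p) a (inj₁ q) = ⊥

  Final : State → Set
  Final (inj₁ _) = ⊥
  Final (inj₂ q) = A₂.Final q

  chop : NFA k
  chop = record
    { State    = State
    ; card     = A₁.card + A₂.card
    ; enum     = ↔-trans +↔⊎ (A₁.enum ⊎-↔ A₂.enum)
    ; Initial  = Initial
    ; Step     = Step
    ; Final    = Final
    ; initial? = λ { a (inj₁ q) → A₁.initial? a q
                   ; a (inj₂ q) → A₂.initial? a q ×-dec
                                  ∃-dec A₁.enum (λ q₁ → A₁.initial? a q₁ ×-dec A₁.final? q₁) }
    ; step?    = λ { (inj₁ p) a (inj₁ q) → A₁.step? p a q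
                   ; (inj₁ p) a (inj₂ q) → A₂.initial? a q ×-dec
                                           ∃-dec A₁.enum (λ q₁ → A₁.step? p a q₁ ×-dec A₁.final? q₁)
                   ; (inj₂ p) a (inj₂ q) → A₂.step? p a q
                   ; (inj₂ p) a (inj₁ q) → no λ () }
    ; final?   = λ { (inj₁ q) → no λ () ; (inj₂ q) → A₂.final? q }
    }

  module _ (σ : Word k) where

    run-inj₁⁻¹ : ∀ {b e q} → Run chop σ b e (inj₁ q) → Run A₁ σ b e q
    run-inj₁⁻¹ (start h)                 = start h
    run-inj₁⁻¹ (extend {p = inj₁ _} r s) = extend (run-inj₁⁻¹ r) s
    run-inj₁⁻¹ (extend {p = inj₂ _} _ ())

    run-inj₁ : ∀ {b e q} → Run A₁ σ b e q → Run chop σ b e (inj₁ q)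
    run-inj₁ (start h)    = start h
    run-inj₁ (extend r s) = extend (run-inj₁ r) s

    run-inj₂⁻¹ : ∀ {b e q} → Run chop σ b e (inj₂ q) →
                 ∃ λ i → Accepts A₁ σ b i × Run A₂ σ i e q
    run-inj₂⁻¹ {b} (start (h₂ , q₁ , h₁ , f₁)) = b , (q₁ , start h₁ , f₁) , start h₂
    run-inj₂⁻¹ (extend {j = j} {p = inj₁ _} r (h₂ , q₁ , s₁ , f₁)) =
      suc j , (q₁ , extend (run-inj₁⁻¹ r) s₁ , f₁) , start h₂
    run-inj₂⁻¹ (extend {p = inj₂ _} r s) =
      let (i , acc , r₂) = run-inj₂⁻¹ r in i , acc , extend r₂ s

    run-inj₂ : ∀ {b i e q} → Accepts A₁ σ b i → Run A₂ σ i e q → Run chop σ b e (inj₂ q)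
    run-inj₂ (q₁ , start h₁ , f₁)     (start h₂)   = start (h₂ , q₁ , h₁ , f₁)
    run-inj₂ (q₁ , extend r₁ s₁ , f₁) (start h₂)   = extend (run-inj₁ r₁) (h₂ , q₁ , s₁ , f₁)
    run-inj₂ acc                      (extend r s) = extend (run-inj₂ acc r) s

    accepts-chop : ∀ b e → Accepts chop σ b e ⇔
      (∃ λ i → b ≤ i × i ≤ e × Accepts A₁ σ b i × Accepts A₂ σ i e)
    accepts-chop b e = mk⇔ split merge
      where
      split : Accepts chop σ b e → ∃ λ i → b ≤ i × i ≤ e × Accepts A₁ σ b i × Accepts A₂ σ i e
      split (inj₂ q , r , f) =
        let (i , acc , r₂) = run-inj₂⁻¹ r in i , accepts-≤ acc , run-≤ r₂ , acc , (q , r₂ , f)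
      merge : (∃ λ i → b ≤ i × i ≤ e × Accepts A₁ σ b i × Accepts A₂ σ i e) → Accepts chop σ b e
      merge (_ , _ , _ , acc , (q , r₂ , f)) = inj₂ q , run-inj₂ acc r₂ , f

-- Chains built from the right: b = i₀, R i₀ i₁, …, R iₘ₋₁ iₘ with iₘ = e.
-- The star automaton produces its segments in this order.
data SnocChain (R : ℕ → ℕ → Set) (b : ℕ) : ℕ → Set where
  nil : SnocChain R b b
  _▷_ : ∀ {i j} → SnocChain R b i → R i j → SnocChain R b j

module _ {R : ℕ → ℕ → Set} where

  snoc-append : ∀ {b i e} → SnocChain R b i → Chain R i e → SnocChain R b e
  snoc-append ch done            = ch
  snoc-append ch (step _ r rest) = snoc-append (ch ▷ r) rest

  chain→snoc : ∀ {b e} → Chain R b e → SnocChain R b e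
  chain→snoc = snoc-append nil

  chain-snoc : ∀ {b i e} → Chain R b i → i ≤ e → R i e → Chain R b e
  chain-snoc done               i≤e r = step i≤e r done
  chain-snoc (step b≤j r' rest) i≤e r = step b≤j r' (chain-snoc rest i≤e r)

  snoc→chain : (∀ {i j} → R i j → i ≤ j) → ∀ {b e} → SnocChain R b e → Chain R b e
  snoc→chain R⇒≤ nil      = done
  snoc→chain R⇒≤ (ch ▷ r) = chain-snoc (snoc→chain R⇒≤ ch) (R⇒≤ r) r

chain-map : ∀ {R R' : ℕ → ℕ → Set} → (∀ {i j} → i ≤ j → R i j → R' i j) →
            ∀ {b e} → Chain R b e → Chain R' b e
chain-map f done              = done
chain-map f (step i≤j r rest) = step i≤j (f i≤j r) (chain-map f rest)

-- Star: a fresh accepting state for the empty iteration on [b, b], and a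
-- restart of A on the letter where an iteration ends.
module Star {k} (A : NFA k) where
  private
    module A = NFA A

  State : Set
  State = ⊤ ⊎ A.State

  EndsAfterStep : A.State → Letter k → Set
  EndsAfterStep p a = ∃ λ q → A.Step p a q × A.Final q

  Initial : Letter k → State → Set
  Initial a (inj₁ _) = ⊤
  Initial a (inj₂ q) = A.Initial a q

  Step : State → Letter k → State → Set
  Step (inj₂ p) a (inj₂ q) = A.Step p a q ⊎ (A.Initial a q × EndsAfterStep p a)
  Step _        _ _        = ⊥

  Final : State → Set
  Final (inj₁ _) = ⊤
  Final (inj₂ q) = A.Final q

  star : NFA k
  star = record
    { State    = State
    ; card     = 1 + A.card
    ; enum     = ↔-trans +↔⊎ (1↔⊤ ⊎-↔ A.enum)
    ; Initial  = Initial
    ; Step     = Step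
    ; Final    = Final
    ; initial? = λ { a (inj₁ _) → yes tt ; a (inj₂ q) → A.initial? a q }
    ; step?    = λ { (inj₂ p) a (inj₂ q) →
                       A.step? p a q ⊎-dec
                       (A.initial? a q ×-dec ∃-dec A.enum (λ r → A.step? p a r ×-dec A.final? r))
                   ; (inj₁ _) a _        → no λ ()
                   ; (inj₂ _) a (inj₁ _) → no λ () }
    ; final?   = λ { (inj₁ _) → yes tt ; (inj₂ q) → A.final? q }
    }

  module _ (σ : Word k) where

    run-point : ∀ {b e t} → Run star σ b e (inj₁ t) → b ≡ e
    run-point (start _)                  = refl
    run-point (extend {p = inj₁ _} _ ())
    run-point (extend {p = inj₂ _} _ ())

    run-inj₂⁻¹ : ∀ {b e q} → Run star σ b e (inj₂ q) →
                 ∃ λ i → SnocChain (Accepts A σ) b i × Run A σ i e q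
    run-inj₂⁻¹ {b} (start h) = b , nil , start h
    run-inj₂⁻¹ (extend {p = inj₁ _} _ ())
    run-inj₂⁻¹ (extend {p = inj₂ _} r (inj₁ s)) =
      let (i , ch , r′) = run-inj₂⁻¹ r in i , ch , extend r′ s
    run-inj₂⁻¹ (extend {j = j} {p = inj₂ _} r (inj₂ (h , q , s , f))) =
      let (i , ch , r′) = run-inj₂⁻¹ r in suc j , ch ▷ (q , extend r′ s , f) , start h

    -- Conversely; segments of length zero are simply skipped.
    run-inj₂ : ∀ {b i e q} → SnocChain (Accepts A σ) b i → Run A σ i e q → Run star σ b e (inj₂ q)
    run-inj₂ ch                          (extend r s) = extend (run-inj₂ ch r) (inj₁ s)
    run-inj₂ nil                         (start h)    = start h
    run-inj₂ (ch ▷ (_ , start _ , _))    (start h)    = run-inj₂ ch (start h)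
    run-inj₂ (ch ▷ (q , extend r s , f)) (start h)    = extend (run-inj₂ ch r) (inj₂ (h , q , s , f))

    accepts-star : ∀ b e → Accepts star σ b e ⇔ Chain (Accepts A σ) b e
    accepts-star b e = mk⇔ split (merge ∘ chain→snoc)
      where
      split : Accepts star σ b e → Chain (Accepts A σ) b e
      split (inj₁ _ , r , _) with run-point r
      ... | refl = done
      split (inj₂ q , r , f) =
        let (i , ch , r′) = run-inj₂⁻¹ r in snoc→chain accepts-≤ (ch ▷ (q , r′ , f))
      merge : SnocChain (Accepts A σ) b e → Accepts star σ b e
      merge nil              = inj₁ tt , start tt , tt
      merge (ch ▷ (q , r , f)) = inj₂ q , run-inj₂ ch r , f

addIf : Bool → ℕ → ℕ
addIf true  n = suc n
addIf false n = n

addIf-suc : ∀ y n → addIf y (suc n) ≡ suc (addIf y n)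
addIf-suc true  n = refl
addIf-suc false n = refl

module Counting {k} (σ : Word k) where

  count-snoc : ∀ φ b n → countP σ φ b (suc n) ≡ addIf (evalP (at σ (b + n)) φ) (countP σ φ b n)
  count-snoc φ b zero rewrite +-identityʳ b with evalP (at σ b) φ
  ... | true  = refl
  ... | false = refl
  count-snoc φ b (suc n) rewrite +-suc b n with evalP (at σ b) φ
  ... | true  = trans (cong suc (count-snoc φ (suc b) n)) (sym (addIf-suc _ _))
  ... | false = count-snoc φ (suc b) n

  count-extend : ∀ φ {b e} → b ≤ e →
    countP σ φ b (suc (e ∸ b)) ≡ addIf (evalP (at σ e) φ) (countP σ φ b (e ∸ b))
  count-extend φ {b} {e} b≤e =
    trans (count-snoc φ b (e ∸ b))
          (cong (λ i → addIf (evalP (at σ i) φ) (countP σ φ b (e ∸ b))) (m+[n∸m]≡n b≤e))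

  count-true : ∀ b n → countP σ ptrue b n ≡ n
  count-true b zero    = refl
  count-true b (suc n) = cong suc (count-true (suc b) n)

  count-zero : ∀ ψ b n →
    countP σ ψ b n ≡ 0 ⇔ (∀ i → b ≤ i → i < b + n → evalP (at σ i) ψ ≡ false)
  count-zero ψ b zero = mk⇔ (λ _ i b≤i i<b+0 → ⊥-elim (<⇒≱ (subst (i <_) (+-identityʳ b) i<b+0) b≤i))
                            (λ _ → refl)
  count-zero ψ b (suc n) with evalP (at σ b) ψ in eq
  ... | true  = mk⇔ (λ ()) (λ h → contradiction (trans (sym eq) (h b ≤-refl (m<m+n b z<s))) λ ())
  ... | false = mk⇔ (λ c≡0 i b≤i i<e → later (to (count-zero ψ (suc b) n) c≡0) i b≤i i<e)
                    (λ h → from (count-zero ψ (suc b) n)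
                             (λ i b<i i<e → h i (<⇒≤ b<i) (subst (i <_) (sym (+-suc b n)) i<e)))
    where
    later : (∀ i → suc b ≤ i → i < suc b + n → evalP (at σ i) ψ ≡ false) →
            ∀ i → b ≤ i → i < b + suc n → evalP (at σ i) ψ ≡ false
    later h i b≤i i<e with m≤n⇒m<n∨m≡n b≤i
    ... | inj₁ b<i  = h i b<i (subst (i <_) (+-suc b n) i<e)
    ... | inj₂ refl = eq

  count-none : ∀ ψ {b e} → b ≤ e →
    countP σ ψ b (e ∸ b) ≡ 0 ⇔ (∀ i → b ≤ i → i < e → evalP (at σ i) ψ ≡ false)
  count-none ψ {b} {e} b≤e =
    ⇔-trans (count-zero ψ b (e ∸ b))
            (≡⇒⇔ (λ m → ∀ i → b ≤ i → i < m → evalP (at σ i) ψ ≡ false) (m+[n∸m]≡n b≤e))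

addIf-⊓ : ∀ y n N → addIf y (n ⊓ N) ⊓ N ≡ addIf y n ⊓ N
addIf-⊓ false n N       = trans (⊓-assoc n N N) (cong (n ⊓_) (⊓-idem N))
addIf-⊓ true  n zero    = refl
addIf-⊓ true  n (suc M) = cong suc (trans (⊓-assoc n (suc M) M) (cong (n ⊓_) (m≥n⇒m⊓n≡n (n≤1+n M))))

⊓1≡0 : ∀ n → n ⊓ 1 ≡ 0 ⇔ n ≡ 0
⊓1≡0 zero    = mk⇔ id id
⊓1≡0 (suc n) = mk⇔ (λ ()) (λ ())

⊓2≡1 : ∀ n → n ⊓ 2 ≡ 1 ⇔ n ≡ 1
⊓2≡1 zero          = mk⇔ (λ ()) (λ ())
⊓2≡1 (suc zero)    = mk⇔ id id
⊓2≡1 (suc (suc n)) = mk⇔ (λ ()) (λ ())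

cmp? : ∀ r x c → Dec (cmpSem r x c)
cmp? `< x c = x <? c
cmp? `≤ x c = x ≤? c
cmp? `= x c = x ≟ c
cmp? `≥ x c = c ≤? x
cmp? `> x c = c <? x

cmp-above : ∀ r {c x y} → c < x → c < y → cmpSem r x c ⇔ cmpSem r y c
cmp-above `< c<x c<y = mk⇔ (λ x<c → ⊥-elim (<-asym x<c c<x)) (λ y<c → ⊥-elim (<-asym y<c c<y))
cmp-above `≤ c<x c<y = mk⇔ (λ x≤c → ⊥-elim (<⇒≱ c<x x≤c)) (λ y≤c → ⊥-elim (<⇒≱ c<y y≤c))
cmp-above `= c<x c<y = mk⇔ (λ { refl → ⊥-elim (<-irrefl refl c<x) }) (λ { refl → ⊥-elim (<-irrefl refl c<y) })
cmp-above `≥ c<x c<y = mk⇔ (λ _ → <⇒≤ c<y) (λ _ → <⇒≤ c<x)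
cmp-above `> c<x c<y = mk⇔ (λ _ → c<y) (λ _ → c<x)

cmp-cap : ∀ r c x → cmpSem r (x ⊓ suc c) c ⇔ cmpSem r x c
cmp-cap r c x with x ≤? c
... | yes x≤c = ≡⇒⇔ (λ n → cmpSem r n c) (m≤n⇒m⊓n≡m (m≤n⇒m≤1+n x≤c))
... | no  x≰c = cmp-above r (subst (c <_) (sym (m≥n⇒m⊓n≡n c<x)) (n<1+n c)) c<x
  where c<x = ≰⇒> x≰c

cmp-cap-addIf : ∀ r c y n → cmpSem r (addIf y (n ⊓ suc c)) c ⇔ cmpSem r (addIf y n) c
cmp-cap-addIf r c y n =
  ⇔-trans (⇔-sym (cmp-cap r c (addIf y (n ⊓ suc c))))
  (⇔-trans (≡⇒⇔ (λ m → cmpSem r m c) (addIf-⊓ y n (suc c)))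
           (cmp-cap r c (addIf y n)))

-- Its state after reading
-- σ(b) ⋯ σ(e) records the value of θ on the first letter, the number of
-- positions in [b, e - 1] satisfying φ capped at N, and the value of φ on
-- the current letter; it accepts when these three values are Good.
module Window {k} (θ φ : Prop k) (N : ℕ)
              (Good : Bool → ℕ → Bool → Set) (good? : ∀ x n y → Dec (Good x n y)) where

  State : Set
  State = Bool × Fin (suc N) × Bool

  cap : ℕ → Fin (suc N)
  cap n = fromℕ< (s≤s (m⊓n≤n n N))

  cap-cong : ∀ {m n} → m ⊓ N ≡ n ⊓ N → cap m ≡ cap n
  cap-cong {m} {n} eq = fromℕ<-cong (m ⊓ N) (n ⊓ N) eq _ _

  first : Letter k → State
  first a = evalP a θ , cap 0 , evalP a φ

  next : State → Letter k → State
  next (x , c , y) a = x , cap (addIf y (toℕ c)) , evalP a φ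

  _≟ˢ_ : (s t : State) → Dec (s ≡ t)
  _≟ˢ_ = ≡-dec _≟ᵇ_ (≡-dec _≟ᶠ_ _≟ᵇ_)

  window : NFA k
  window = record
    { State    = State
    ; card     = 2 * (suc N * 2)
    ; enum     = ↔-trans *↔× (2↔Bool ×-↔ ↔-trans *↔× (↔-refl ×-↔ 2↔Bool))
    ; Initial  = λ a s → s ≡ first a
    ; Step     = λ p a s → s ≡ next p a
    ; Final    = λ (x , c , y) → Good x (toℕ c) y
    ; initial? = λ a s → s ≟ˢ first a
    ; step?    = λ p a s → s ≟ˢ next p a
    ; final?   = λ (x , c , y) → good? x (toℕ c) y
    }

  module _ (σ : Word k) where
    open Counting σ

    summary : ℕ → ℕ → State
    summary b e = evalP (at σ b) θ , cap (countP σ φ b (e ∸ b)) , evalP (at σ e) φ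

    summary-start : ∀ b → first (at σ b) ≡ summary b b
    summary-start b =
      cong (λ n → evalP (at σ b) θ , cap (countP σ φ b n) , evalP (at σ b) φ) (sym (n∸n≡0 b))

    summary-next : ∀ {b j} → b ≤ j → next (summary b j) (at σ (suc j)) ≡ summary b (suc j)
    summary-next {b} {j} b≤j =
      cong (λ c → evalP (at σ b) θ , c , evalP (at σ (suc j)) φ) (cap-cong (begin
        addIf y (toℕ (cap n)) ⊓ N       ≡⟨ cong (λ m → addIf y m ⊓ N) (toℕ-fromℕ< _) ⟩
        addIf y (n ⊓ N) ⊓ N             ≡⟨ addIf-⊓ y n N ⟩
        addIf y n ⊓ N                   ≡⟨ cong (_⊓ N) (sym (count-extend φ b≤j)) ⟩
        countP σ φ b (suc (j ∸ b)) ⊓ N  ≡⟨ cong (λ m → countP σ φ b m ⊓ N) (sym (+-∸-assoc 1 b≤j)) ⟩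
        countP σ φ b (suc j ∸ b) ⊓ N    ∎))
      where
      open ≡-Reasoning
      y = evalP (at σ j) φ
      n = countP σ φ b (j ∸ b)

    run-summary⁻¹ : ∀ {b e s} → Run window σ b e s → s ≡ summary b e
    run-summary⁻¹ {b} (start refl) = summary-start b
    run-summary⁻¹ (extend {j = j} r refl) =
      trans (cong (λ p → next p (at σ (suc j))) (run-summary⁻¹ r)) (summary-next (run-≤ r))

    run-summary : ∀ {b} e → b ≤ e → Run window σ b e (summary b e)
    run-summary e b≤e with m≤n⇒m<n∨m≡n b≤e
    run-summary {b} _ _ | inj₂ refl   = start (sym (summary-start b))
    run-summary zero    _ | inj₁ ()
    run-summary (suc j) _ | inj₁ b<1+j =
      extend (run-summary j (≤-pred b<1+j)) (sym (summary-next (≤-pred b<1+j)))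

    accepts-window : ∀ {b e} → b ≤ e →
      Accepts window σ b e ⇔ Good (evalP (at σ b) θ) (countP σ φ b (e ∸ b) ⊓ N) (evalP (at σ e) φ)
    accepts-window {b} {e} b≤e = mk⇔
      (λ (s , r , f) → to final-summary (subst (NFA.Final window) (run-summary⁻¹ r) f))
      (λ g → summary b e , run-summary e b≤e , from final-summary g)
      where
      final-summary : NFA.Final window (summary b e) ⇔
                      Good (evalP (at σ b) θ) (countP σ φ b (e ∸ b) ⊓ N) (evalP (at σ e) φ)
      final-summary = ≡⇒⇔ (λ n → Good (evalP (at σ b) θ) n (evalP (at σ e) φ)) (toℕ-fromℕ< _)

  window-recognises : ∀ {D} →
    (∀ σ b e → b ≤ e →
       Good (evalP (at σ b) θ) (countP σ φ b (e ∸ b) ⊓ N) (evalP (at σ e) φ) ⇔ Sat D σ b e) →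
    Recognises window D
  window-recognises key σ b e b≤e = ⇔-trans (accepts-window σ b≤e) (key σ b e b≤e)

module Atomic {k} (σ : Word k) where
  open Counting σ

  not-false : ∀ x → not x ≡ false ⇔ x ≡ true
  not-false x = mk⇔ not-injective (cong not)

  upto-split : ∀ {P : ℕ → Set} {b e} → b ≤ e →
    ((∀ i → b ≤ i → i < e → P i) × P e) ⇔ (∀ i → b ≤ i → i ≤ e → P i)
  upto-split {P} {b} {e} b≤e = mk⇔ join (λ h → (λ i b≤i i<e → h i b≤i (<⇒≤ i<e)) , h e b≤e ≤-refl)
    where
    join : ((∀ i → b ≤ i → i < e → P i) × P e) → ∀ i → b ≤ i → i ≤ e → P i
    join (h , pe) i b≤i i≤e with m≤n⇒m<n∨m≡n i≤e
    ... | inj₁ i<e  = h i b≤i i<e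
    ... | inj₂ refl = pe

  length-one : ∀ {b e} → b ≤ e → e ∸ b ≡ 1 ⇔ e ≡ suc b
  length-one {b} b≤e = mk⇔ (λ h → trans (sym (m∸n+n≡m b≤e)) (cong (_+ b) h))
                           (λ { refl → m+n∸n≡m 1 b })

  box-key : ∀ ψ {b e} → b ≤ e →
    countP σ (p¬ ψ) b (e ∸ b) ⊓ 1 ≡ 0 ⇔ Sat [ ψ ] σ b e
  box-key ψ b≤e =
    ⇔-trans (⊓1≡0 _) (⇔-trans (count-none (p¬ ψ) b≤e)
      (mk⇔ (λ h i b≤i i<e → to (not-false _) (h i b≤i i<e))
           (λ h i b≤i i<e → from (not-false _) (h i b≤i i<e))))

  closed-box-key : ∀ ψ {b e} → b ≤ e →
    (countP σ (p¬ ψ) b (e ∸ b) ⊓ 1 ≡ 0 × not (evalP (at σ e) ψ) ≡ false) ⇔ Sat [[ ψ ]] σ b e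
  closed-box-key ψ b≤e = ⇔-trans (box-key ψ b≤e ×-⇔ not-false _) (upto-split b≤e)

  unit-key : ∀ ψ {b e} → b ≤ e →
    (countP σ ptrue b (e ∸ b) ⊓ 2 ≡ 1 × evalP (at σ b) ψ ≡ true) ⇔ Sat ⦃⦃ ψ ⦄⦄ σ b e
  unit-key ψ {b} {e} b≤e =
    ⇔-trans (≡⇒⇔ (λ n → n ⊓ 2 ≡ 1) (count-true b (e ∸ b))) (⇔-trans (⊓2≡1 _) (length-one b≤e))
    ×-⇔ mk⇔ id id

  length-key : ∀ r c {b e} →
    cmpSem r (countP σ ptrue b (e ∸ b) ⊓ suc c) c ⇔ Sat (slen r c) σ b e
  length-key r c {b} {e} =
    ⇔-trans (cmp-cap r c _) (≡⇒⇔ (λ n → cmpSem r n c) (count-true b (e ∸ b)))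

  duration-key : ∀ ψ r c {b e} →
    cmpSem r (countP σ ψ b (e ∸ b) ⊓ suc c) c ⇔ Sat (sdur ψ r c) σ b e
  duration-key ψ r c = cmp-cap r c _

  count-key : ∀ ψ r c {b e} → b ≤ e →
    cmpSem r (addIf (evalP (at σ e) ψ) (countP σ ψ b (e ∸ b) ⊓ suc c)) c ⇔ Sat (scount ψ r c) σ b e
  count-key ψ r c {b} {e} b≤e =
    ⇔-trans (cmp-cap-addIf r c (evalP (at σ e) ψ) (countP σ ψ b (e ∸ b)))
            (≡⇒⇔ (λ n → cmpSem r n c) (sym (count-extend ψ b≤e)))

Bound : ℕ → ℕ
Bound s = 2 ^ 2 ^ s

twice : ∀ x → 2 * x ≡ x + x
twice x = cong (x +_) (+-identityʳ x)

n<2^n : ∀ n → n < 2 ^ n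
n<2^n zero    = z<s
n<2^n (suc n) = subst (suc (suc n) ≤_) (sym (twice (2 ^ n))) (+-mono-≤ (m^n>0 2 n) (n<2^n n))

binLen-bound : ∀ c → c < 2 ^ binLen c
binLen-bound c with c <? 2 ^ binLen c
... | yes c<2^L = c<2^L
... | no  c≮2^L = ⊥-elim (1+n≰n (begin
        suc ⌊log₂ c ⌋              ≡⟨ sym (⌊log₂[2^n]⌋≡n (binLen c)) ⟩
        ⌊log₂ (2 ^ binLen c) ⌋     ≤⟨ ⌊log₂⌋-mono-≤ (≮⇒≥ c≮2^L) ⟩
        ⌊log₂ c ⌋                  ∎))
  where open ≤-Reasoning

Bound-mono : ∀ {s t} → s ≤ t → Bound s ≤ Bound t
Bound-mono s≤t = ^-monoʳ-≤ 2 (^-monoʳ-≤ 2 s≤t)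

Bound-square : ∀ t → Bound t * Bound t ≡ Bound (suc t)
Bound-square t = trans (sym (^-distribˡ-+-* 2 (2 ^ t) (2 ^ t))) (cong (2 ^_) (sym (twice (2 ^ t))))

Bound-double : ∀ t → Bound t + Bound t ≤ Bound (suc t)
Bound-double t = begin
  Bound t + Bound t     ≡⟨ sym (twice (Bound t)) ⟩
  2 * Bound t           ≤⟨ *-monoˡ-≤ (Bound t) (^-monoʳ-≤ 2 (m^n>0 2 t)) ⟩
  Bound t * Bound t     ≡⟨ Bound-square t ⟩
  Bound (suc t)         ∎
  where open ≤-Reasoning

Bound-operands : ∀ {m₁ m₂} s₁ s₂ → m₁ ≤ Bound s₁ → m₂ ≤ Bound s₂ →
                 m₁ ≤ Bound (s₁ + s₂) × m₂ ≤ Bound (s₁ + s₂)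
Bound-operands s₁ s₂ h₁ h₂ =
  ≤-trans h₁ (Bound-mono (m≤m+n s₁ s₂)) , ≤-trans h₂ (Bound-mono (m≤n+m s₂ s₁))

size-join : ∀ s₁ s₂ → s₁ + 1 + s₂ ≡ suc (s₁ + s₂)
size-join s₁ s₂ = trans (+-assoc s₁ 1 s₂) (+-suc s₁ s₂)

sum-bound : ∀ {m₁ m₂} s₁ s₂ → m₁ ≤ Bound s₁ → m₂ ≤ Bound s₂ →
            m₁ + m₂ ≤ Bound (s₁ + 1 + s₂)
sum-bound {m₁} {m₂} s₁ s₂ h₁ h₂ = begin
  m₁ + m₂                        ≤⟨ +-mono-≤ h₁′ h₂′ ⟩
  Bound (s₁ + s₂) + Bound (s₁ + s₂) ≤⟨ Bound-double (s₁ + s₂) ⟩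
  Bound (suc (s₁ + s₂))          ≡⟨ cong Bound (sym (size-join s₁ s₂)) ⟩
  Bound (s₁ + 1 + s₂)            ∎
  where
  open ≤-Reasoning
  h₁′ = proj₁ (Bound-operands s₁ s₂ h₁ h₂)
  h₂′ = proj₂ (Bound-operands s₁ s₂ h₁ h₂)

product-bound : ∀ {m₁ m₂} s₁ s₂ → m₁ ≤ Bound s₁ → m₂ ≤ Bound s₂ →
                m₁ * m₂ ≤ Bound (s₁ + 1 + s₂)
product-bound {m₁} {m₂} s₁ s₂ h₁ h₂ = begin
  m₁ * m₂                           ≤⟨ *-mono-≤ h₁′ h₂′ ⟩
  Bound (s₁ + s₂) * Bound (s₁ + s₂) ≡⟨ Bound-square (s₁ + s₂) ⟩
  Bound (suc (s₁ + s₂))             ≡⟨ cong Bound (sym (size-join s₁ s₂)) ⟩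
  Bound (s₁ + 1 + s₂)               ∎
  where
  open ≤-Reasoning
  h₁′ = proj₁ (Bound-operands s₁ s₂ h₁ h₂)
  h₂′ = proj₂ (Bound-operands s₁ s₂ h₁ h₂)

star-bound : ∀ {m} s → m ≤ Bound s → 1 + m ≤ Bound (s + 1)
star-bound {m} s h = begin
  1 + m               ≤⟨ +-mono-≤ (m^n>0 2 (2 ^ s)) h ⟩
  Bound s + Bound s   ≤⟨ Bound-double s ⟩
  Bound (suc s)       ≡⟨ cong Bound (+-comm 1 s) ⟩
  Bound (s + 1)       ∎
  where open ≤-Reasoning

window-bound : ∀ N L → suc N ≤ 2 ^ L → 2 * (suc N * 2) ≤ Bound (suc L)
window-bound N L width = begin
  2 * (suc N * 2)     ≤⟨ *-monoʳ-≤ 2 (*-monoˡ-≤ 2 width) ⟩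
  2 * (2 ^ L * 2)     ≡⟨ cong (2 *_) (*-comm (2 ^ L) 2) ⟩
  2 ^ (2 + L)         ≤⟨ ^-monoʳ-≤ 2 (n<2^n (suc L)) ⟩
  Bound (suc L)       ∎
  where open ≤-Reasoning

counter-width : ∀ c → suc (suc c) ≤ 2 ^ suc (binLen c)
counter-width c = subst (suc (suc c) ≤_) (sym (twice (2 ^ binLen c)))
                        (+-mono-≤ (m^n>0 2 (binLen c)) (binLen-bound c))

determinised-bound : ∀ {m} n → m ≤ Bound n → suc (2 ^ m) ≤ 2 * 2 ^ 2 ^ 2 ^ n
determinised-bound {m} n h = begin
  suc (2 ^ m)         ≤⟨ +-monoˡ-≤ (2 ^ m) (m^n>0 2 m) ⟩
  2 ^ m + 2 ^ m       ≡⟨ sym (twice (2 ^ m)) ⟩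
  2 * 2 ^ m           ≤⟨ *-monoʳ-≤ 2 (^-monoʳ-≤ 2 h) ⟩
  2 * 2 ^ Bound n     ∎
  where open ≤-Reasoning

record Compiled {k} (D : QDDC k) : Set₁ where
  field
    automaton  : NFA k
    within     : NFA.card automaton ≤ Bound (size D)
    recognises : Recognises automaton D

open Compiled

compile-window : ∀ {k} {D : QDDC k} (θ φ : Prop k) (N L : ℕ)
  {Good : Bool → ℕ → Bool → Set} (good? : ∀ x n y → Dec (Good x n y)) →
  suc N ≤ 2 ^ L → suc L ≤ size D →
  (∀ σ b e → b ≤ e →
     Good (evalP (at σ b) θ) (countP σ φ b (e ∸ b) ⊓ N) (evalP (at σ e) φ) ⇔ Sat D σ b e) →
  Compiled D
compile-window {D = D} θ φ N L {Good} good? width fits key = record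
  { automaton  = Window.window θ φ N Good good?
  ; within     = ≤-trans (window-bound N L width) (Bound-mono fits)
  ; recognises = Window.window-recognises θ φ N Good good? {D} key
  }

compile-∨ : ∀ {k} {D₁ D₂ : QDDC k} → Compiled D₁ → Compiled D₂ → Compiled (D₁ ∨ᴰ D₂)
compile-∨ {D₁ = D₁} {D₂} C₁ C₂ = record
  { automaton  = Union.union (automaton C₁) (automaton C₂)
  ; within     = sum-bound (size D₁) (size D₂) (within C₁) (within C₂)
  ; recognises = λ σ b e b≤e →
      ⇔-trans (Union.accepts-union (automaton C₁) (automaton C₂) σ b e)
              (recognises C₁ σ b e b≤e ⊎-⇔ recognises C₂ σ b e b≤e)
  }

compile-∧ : ∀ {k} {D₁ D₂ : QDDC k} → Compiled D₁ → Compiled D₂ → Compiled (D₁ ∧ᴰ D₂)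
compile-∧ {D₁ = D₁} {D₂} C₁ C₂ = record
  { automaton  = Product.product (automaton C₁) (automaton C₂)
  ; within     = product-bound (size D₁) (size D₂) (within C₁) (within C₂)
  ; recognises = λ σ b e b≤e →
      ⇔-trans (Product.accepts-product (automaton C₁) (automaton C₂) σ b e)
              (recognises C₁ σ b e b≤e ×-⇔ recognises C₂ σ b e b≤e)
  }

compile-⁀ : ∀ {k} {D₁ D₂ : QDDC k} → Compiled D₁ → Compiled D₂ → Compiled (D₁ ⁀ D₂)
compile-⁀ {D₁ = D₁} {D₂} C₁ C₂ = record
  { automaton  = Chop.chop (automaton C₁) (automaton C₂)
  ; within     = sum-bound (size D₁) (size D₂) (within C₁) (within C₂)
  ; recognises = λ σ b e b≤e →
      ⇔-trans (Chop.accepts-chop (automaton C₁) (automaton C₂) σ b e) (mk⇔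
        (λ (i , b≤i , i≤e , a₁ , a₂) →
           i , b≤i , i≤e , to (recognises C₁ σ b i b≤i) a₁ , to (recognises C₂ σ i e i≤e) a₂)
        (λ (i , b≤i , i≤e , d₁ , d₂) →
           i , b≤i , i≤e , from (recognises C₁ σ b i b≤i) d₁ , from (recognises C₂ σ i e i≤e) d₂))
  }

compile-⋆ : ∀ {k} {D : QDDC k} → Compiled D → Compiled (D ⋆)
compile-⋆ {D = D} C = record
  { automaton  = Star.star (automaton C)
  ; within     = star-bound (size D) (within C)
  ; recognises = λ σ b e _ →
      ⇔-trans (Star.accepts-star (automaton C) σ b e) (mk⇔
        (chain-map (λ {i} {j} i≤j → to (recognises C σ i j i≤j)))
        (chain-map (λ {i} {j} i≤j → from (recognises C σ i j i≤j))))
  }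

compile : ∀ {k} (D : QDDC k) → IsSeCe D → Compiled D
compile ⟨ ψ ⟩ (s⟨⟩ _) =
  compile-window ψ ptrue 1 1 (λ x _ _ → x ≟ᵇ true) ≤-refl (m≤m+n 2 (sizeP ψ))
    (λ σ b e _ → mk⇔ id id)
compile [ ψ ] (s[] _) =
  compile-window ptrue (p¬ ψ) 1 1 (λ _ n _ → n ≟ 0) ≤-refl (m≤m+n 2 (sizeP ψ))
    (λ σ b e b≤e → Atomic.box-key σ ψ b≤e)
compile [[ ψ ]] (s[[]] _) =
  compile-window ptrue (p¬ ψ) 1 1 (λ _ n y → (n ≟ 0) ×-dec (y ≟ᵇ false)) ≤-refl
    (m≤m+n 2 (2 + sizeP ψ))
    (λ σ b e b≤e → Atomic.closed-box-key σ ψ b≤e)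
compile ⦃⦃ ψ ⦄⦄ (s⦃⦃⦄⦄ _) =
  compile-window ψ ptrue 2 2 (λ x n _ → (n ≟ 1) ×-dec (x ≟ᵇ true)) (n≤1+n 3)
    (m≤m+n 3 (1 + sizeP ψ))
    (λ σ b e b≤e → Atomic.unit-key σ ψ b≤e)
compile (slen r c) (sslen _ _) =
  compile-window ptrue ptrue (suc c) (suc (binLen c)) (λ _ n _ → cmp? r n c)
    (counter-width c) ≤-refl
    (λ σ b e _ → Atomic.length-key σ r c {b} {e})
compile (sdur ψ r c) (ssdur _ _ _) =
  compile-window ptrue ψ (suc c) (suc (binLen c)) (λ _ n _ → cmp? r n c)
    (counter-width c) (+-monoˡ-≤ (binLen c) (m≤m+n 2 (sizeP ψ)))
    (λ σ b e _ → Atomic.duration-key σ ψ r c {b} {e})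
compile (scount ψ r c) (sscount _ _ _) =
  compile-window ptrue ψ (suc c) (suc (binLen c)) (λ _ n y → cmp? r (addIf y n) c)
    (counter-width c) (+-monoˡ-≤ (binLen c) (m≤m+n 2 (sizeP ψ)))
    (λ σ b e b≤e → Atomic.count-key σ ψ r c b≤e)
compile (D₁ ⁀ D₂)  (s⁀ s₁ s₂) = compile-⁀ (compile D₁ s₁) (compile D₂ s₂)
compile (D₁ ∨ᴰ D₂) (s∨ s₁ s₂) = compile-∨ (compile D₁ s₁) (compile D₂ s₂)
compile (D₁ ∧ᴰ D₂) (s∧ s₁ s₂) = compile-∧ (compile D₁ s₁) (compile D₂ s₂)
compile (D ⋆)      (s⋆ s)     = compile-⋆ (compile D s)

drop-∷ : ∀ {k} (xs : List (Letter k)) n {y ys} → drop n xs ≡ y ∷ ys → atL xs n ≡ y × drop (suc n) xs ≡ ys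
drop-∷ []       zero    ()
drop-∷ []       (suc n) ()
drop-∷ (x ∷ xs) zero    refl = refl , refl
drop-∷ (x ∷ xs) (suc n) h    = drop-∷ xs n h

-- The DFA has one state for the empty prefix and
-- one for every set of states of A; after a non-empty prefix σ(0) ⋯ σ(j)
-- it is in the set of states in which a run of A on [0, j] can end.
module Determinise {k} (A : NFA k) where
  open NFA A
  private
    module Enum = Inverse enum
    module Code = Inverse (bitVectors card)

  StateSet : Set
  StateSet = Vec Bool card

  _∋_ : StateSet → State → Set
  S ∋ q = lookup S (Enum.from q) ≡ true

  _∋?_ : ∀ S q → Dec (S ∋ q)
  S ∋? q = lookup S (Enum.from q) ≟ᵇ true

  select : {P : State → Set} → (∀ q → Dec (P q)) → StateSet
  select P? = tabulate (λ i → does (P? (Enum.to i)))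

  select-∋ : ∀ {P : State → Set} (P? : ∀ q → Dec (P q)) q → select P? ∋ q ⇔ P q
  select-∋ P? q = ⇔-trans (≡⇒⇔ (_≡ true) entry) (does-true (P? q))
    where
    entry : lookup (select P?) (Enum.from q) ≡ does (P? q)
    entry = trans (lookup∘tabulate _ (Enum.from q))
                  (cong (λ s → does (P? s)) (Enum.strictlyInverseˡ q))

  initialSet : Letter k → StateSet
  initialSet a = select (initial? a)

  successor? : ∀ S a q → Dec (∃ λ p → S ∋ p × Step p a q)
  successor? S a q = ∃-dec enum (λ p → (S ∋? p) ×-dec step? p a q)

  stepSet : StateSet → Letter k → StateSet
  stepSet S a = select (successor? S a)

  accepting? : ∀ S → Dec (∃ λ q → S ∋ q × Final q)
  accepting? S = ∃-dec enum (λ q → (S ∋? q) ×-dec final? q)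

  transition : Fin (suc (2 ^ card)) → Letter k → Fin (suc (2 ^ card))
  transition zero    a = suc (Code.from (initialSet a))
  transition (suc x) a = suc (Code.from (stepSet (Code.to x) a))

  accepting : Fin (suc (2 ^ card)) → Bool
  accepting zero    = false
  accepting (suc x) = does (accepting? (Code.to x))

  dfa : DFA k
  dfa = record { states = suc (2 ^ card) ; start = zero ; δ = transition ; final = accepting }

  module _ (σ : Word k) where

    reachable : ℕ → StateSet
    reachable zero    = initialSet (at σ 0)
    reachable (suc e) = stepSet (reachable e) (at σ (suc e))

    reachable-∋ : ∀ e q → reachable e ∋ q ⇔ Run A σ 0 e q
    reachable-∋ zero    q = ⇔-trans (select-∋ (initial? (at σ 0)) q) (mk⇔ start λ { (start h) → h })
    reachable-∋ (suc e) q = ⇔-trans (select-∋ (successor? (reachable e) (at σ (suc e))) q) (mk⇔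
      (λ (p , p∈ , s) → extend (to (reachable-∋ e p) p∈) s)
      (λ { (extend {p = p} r s) → p , from (reachable-∋ e p) r , s }))

    code : ℕ → Fin (suc (2 ^ card))
    code j = suc (Code.from (reachable j))

    transition-code : ∀ j → transition (code j) (at σ (suc j)) ≡ code (suc j)
    transition-code j =
      cong (λ S → suc (Code.from (stepSet S (at σ (suc j))))) (Code.strictlyInverseˡ (reachable j))

    run-from : ∀ j ys → drop (suc j) (toList σ) ≡ ys → foldl transition (code j) ys ≡ code (j + length ys)
    run-from j []       _    = cong code (sym (+-identityʳ j))
    run-from j (y ∷ ys) rest = begin
      foldl transition (transition (code j) y) ys
        ≡⟨ cong (λ a → foldl transition (transition (code j) a) ys) (sym at≡y) ⟩
      foldl transition (transition (code j) (at σ (suc j))) ys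
        ≡⟨ cong (λ s → foldl transition s ys) (transition-code j) ⟩
      foldl transition (code (suc j)) ys
        ≡⟨ run-from (suc j) ys rest′ ⟩
      code (suc j + length ys)
        ≡⟨ cong code (sym (+-suc j (length ys))) ⟩
      code (j + length (y ∷ ys))
        ∎
      where
      open ≡-Reasoning
      at≡y  = proj₁ (drop-∷ (toList σ) (suc j) rest)
      rest′ = proj₂ (drop-∷ (toList σ) (suc j) rest)

  run-dfa : ∀ σ → foldl transition zero (toList σ) ≡ code σ (lastIdx σ)
  run-dfa σ@(_ ∷ xs) = run-from σ 0 xs refl

  accepts-dfa : ∀ σ → accepts dfa (toList σ) ≡ true ⇔ Accepts A σ 0 (lastIdx σ)
  accepts-dfa σ = ⇔-trans (≡⇒⇔ (_≡ true) final-state) (⇔-trans (does-true (accepting? R)) (mk⇔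
    (λ (q , q∈ , f) → q , to (reachable-∋ σ (lastIdx σ) q) q∈ , f)
    (λ (q , r , f) → q , from (reachable-∋ σ (lastIdx σ) q) r , f)))
    where
    R = reachable σ (lastIdx σ)
    final-state : accepts dfa (toList σ) ≡ does (accepting? R)
    final-state = trans (cong accepting (run-dfa σ)) (cong (does ∘ accepting?) (Code.strictlyInverseˡ R))

mainTheorem2 : (k : ℕ) →
    Σ ℕ λ C →
    Σ ((D : QDDC k) → IsSeCe D → DFA k) λ build →
    (D : QDDC k) (s : IsSeCe D) →
      (DFA.states (build D s) ≤ C * 2 ^ (2 ^ (2 ^ size D)))
      × (accepts (build D s) [] ≡ false)
      × ((σ : Word k) → (accepts (build D s) (toList σ) ≡ true ⇔ σ ⊨ D))
mainTheorem2 k = 2 , build , λ D s →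
    determinised-bound (size D) (within (compile D s))
  , refl
  , λ σ → ⇔-trans (Determinise.accepts-dfa (automaton (compile D s)) σ)
                  (recognises (compile D s) σ 0 (lastIdx σ) z≤n)
  where
  build : (D : QDDC k) → IsSeCe D → DFA k
  build D s = Determinise.dfa (automaton (compile D s))
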